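{- Let $b_n$ be the number of marked ordered trees with distinguished children having $n$ nodes, and let $A(z)=\sum_{n\ge1}b_nz^n$. Then $$A(z)=z+\frac{zA(z)}{(1-A(z))^2}+\frac{z\,(A(z)-z)}{(1-A(z))^2},$$ equivalently $-A^3+2A^2-A+zA^2+z-z^2=0$ with $A=A(z)$; in particular $A(z)=z+z^2+4z^3+17z^4+78z^5+378z^6+\cdots$.
   Context: An ordered (plane) tree consists of a root together with an ordered sequence of $m\ge 0$ subtrees, each recursively an ordered tree. A marked ordered tree is an ordered tree in which every edge that is the rightmost edge from a node to its children, and whose lower endpoint is not a leaf (a node with no children), may be either marked or unmarked; all other edges are unmarked. A marked ordered tree with distinguished children is a marked ordered tree in which additionally, for every node having at least one child, exactly one of its children is designated as distinguished. Two such objects are different if their underlying ordered trees, their markings, or their choices of distinguished children differ. Size is the number of nodes. -}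

module Defs where

open import Data.Nat as ℕ using (ℕ; zero; suc; _∸_)
open import Data.Integer as ℤ using (ℤ; +_; _+_; _*_; -_)
open import Data.List using (List; []; _∷_; length; map; upTo)
open import Data.List.Relation.Unary.All using (All)
open import Data.Bool using (Bool)
open import Data.Unit using (⊤)
open import Data.Fin using (Fin)
open import Data.Product using (Σ; proj₁)

data Tree : Set where
  node : List Tree → Tree

size     : Tree → ℕ
sizeList : List Tree → ℕ
size (node cs) = suc (sizeList cs)
sizeList []       = 0
sizeList (c ∷ cs) = size c ℕ.+ sizeList cs

RightMark : Tree → Set
RightMark (node [])      = ⊤
RightMark (node (_ ∷ _)) = Bool

-- Marking choice for a node with children cs: only the rightmost edge
-- (to the last child) may be marked, and only if that child is not a leaf.
MarkChoice : List Tree → Set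
MarkChoice []           = ⊤
MarkChoice (c ∷ [])     = RightMark c
MarkChoice (_ ∷ d ∷ cs) = MarkChoice (d ∷ cs)

DistChoice : List Tree → Set
DistChoice []         = ⊤
DistChoice (c ∷ cs)   = Fin (length (c ∷ cs))

-- Decorations of an ordered tree turning it into a marked ordered tree
-- with distinguished children: at every node, a marking choice and a
-- distinguished-child choice, recursively in all subtrees.
data Deco : Tree → Set where
  deco : ∀ {cs} → MarkChoice cs → DistChoice cs → All Deco cs → Deco (node cs)

MDTree : Set
MDTree = Σ Tree Deco

MDTreeOfSize : ℕ → Set
MDTreeOfSize n = Σ MDTree (λ t → size (proj₁ t) ≡ n)
  where open import Relation.Binary.PropositionalEquality using (_≡_)

Series : Set
Series = ℕ → ℤ

_⊕_ : Series → Series → Series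
(f ⊕ g) n = f n + g n

⊝_ : Series → Series
(⊝ f) n = - f n

sumℤ : List ℤ → ℤ
sumℤ []       = + 0
sumℤ (x ∷ xs) = x + sumℤ xs

_⊛_ : Series → Series → Series
(f ⊛ g) n = sumℤ (map (λ i → f i * g (n ∸ i)) (upTo (suc n)))

infixl 6 _⊕_
infixl 7 _⊛_
infix 8 ⊝_

zS : Series
zS 1 = + 1
zS _ = + 0

twoS : Series
twoS 0 = + 2
twoS _ = + 0

genFun : (ℕ → ℕ) → Series
genFun b zero    = + 0
genFun b (suc n) = + b (suc n)

-- Removing the root of a marked ordered tree with distinguished children leaves nothing or the
-- nonempty list of its children, one of them distinguished; the edge to the last child carries a
-- free mark exactly when that child is not a leaf. Let H and G count such lists of children with
-- and without a distinguished child, and W trees together with the marking choice of the edge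
-- above them. Splitting off the first child gives
--   A = z(1 + H),   W = z(1 + 2H) = 2A − z,   G = W + AG,   H = W + A(G + H),
-- so G(1 − A) = W, H(1 − A)² = W, and (A − z)(1 − A)² = zH(1 − A)² = z(2A − z), which is the cubic.
-- The counts are computed by the recursion these equations induce, and every equation is realised
-- by a size-preserving bijection.

module Submission where

open import Defs
open import Data.Nat using (ℕ)
open import Data.Integer using (+_)
open import Data.Fin using (Fin)
open import Data.Product using (Σ; _×_)
open import Function.Bundles using (_↔_)
open import Relation.Binary.PropositionalEquality using (_≡_)

module PowerSeries where

  open import Data.Nat using (zero; suc; _∸_)
  open import Data.Integer using (ℤ; +_; _+_; _*_)
  import Data.Integer.Properties as ℤ
  open import Data.Integer.Tactic.RingSolver using (solve-∀)
  open import Data.List using (applyUpTo)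
  open import Data.List.Properties using (map-upTo)
  open import Data.Product using (_,_)
  open import Function using (_∘_)
  open import Algebra.Bundles using (CommutativeRing)
  open import Algebra.Structures using (IsCommutativeRing)
  import Algebra.Construct.Pointwise as Pointwise
  open import Relation.Binary.PropositionalEquality
  open ≡-Reasoning

  const : ℤ → Series
  const c zero    = c
  const c (suc _) = + 0

  0ₛ : Series
  0ₛ _ = + 0

  1ₛ : Series
  1ₛ = const (+ 1)

  tail : Series → Series
  tail f n = f (suc n)

  cauchy : Series → Series → Series
  cauchy f g zero    = f 0 * g 0
  cauchy f g (suc n) = f 0 * g (suc n) + cauchy (tail f) g n

  sumℤ-applyUpTo-cauchy : ∀ f g n →
    sumℤ (applyUpTo (λ i → f i * g (n ∸ i)) (suc n)) ≡ cauchy f g n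
  sumℤ-applyUpTo-cauchy f g zero    = ℤ.+-identityʳ (f 0 * g 0)
  sumℤ-applyUpTo-cauchy f g (suc n) = cong (_+_ (f 0 * g (suc n))) (sumℤ-applyUpTo-cauchy (tail f) g n)

  ⊛≗cauchy : ∀ f g → f ⊛ g ≗ cauchy f g
  ⊛≗cauchy f g n = trans (cong sumℤ (map-upTo (λ i → f i * g (n ∸ i)) (suc n))) (sumℤ-applyUpTo-cauchy f g n)

  cauchy-cong : ∀ {f f′ g g′} → f ≗ f′ → g ≗ g′ → cauchy f g ≗ cauchy f′ g′
  cauchy-cong f≗f′ g≗g′ zero    = cong₂ _*_ (f≗f′ 0) (g≗g′ 0)
  cauchy-cong f≗f′ g≗g′ (suc n) =
    cong₂ _+_ (cong₂ _*_ (f≗f′ 0) (g≗g′ (suc n))) (cauchy-cong (f≗f′ ∘ suc) g≗g′ n)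

  cauchy-zeroˡ : ∀ g → cauchy 0ₛ g ≗ 0ₛ
  cauchy-zeroˡ g zero    = refl
  cauchy-zeroˡ g (suc n) = trans (ℤ.+-identityˡ _) (cauchy-zeroˡ g n)

  cauchy-identityˡ : ∀ g → cauchy 1ₛ g ≗ g
  cauchy-identityˡ g zero    = ℤ.*-identityˡ (g 0)
  cauchy-identityˡ g (suc n) = begin
    + 1 * g (suc n) + cauchy 0ₛ g n ≡⟨ cong₂ _+_ (ℤ.*-identityˡ (g (suc n))) (cauchy-zeroˡ g n) ⟩
    g (suc n) + + 0                 ≡⟨ ℤ.+-identityʳ (g (suc n)) ⟩
    g (suc n)                       ∎

  cauchy-constˡ : ∀ c g → cauchy (const c) g ≗ λ n → c * g n
  cauchy-constˡ c g zero    = refl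
  cauchy-constˡ c g (suc n) = trans (cong (_+_ (c * g (suc n))) (cauchy-zeroˡ g n)) (ℤ.+-identityʳ _)

  cauchy-distribʳ : ∀ f f′ g → cauchy (f ⊕ f′) g ≗ cauchy f g ⊕ cauchy f′ g
  cauchy-distribʳ f f′ g zero    = ℤ.*-distribʳ-+ (g 0) (f 0) (f′ 0)
  cauchy-distribʳ f f′ g (suc n) = begin
    (f 0 + f′ 0) * g (suc n) + cauchy (tail f ⊕ tail f′) g n
      ≡⟨ cong₂ _+_ (ℤ.*-distribʳ-+ (g (suc n)) (f 0) (f′ 0)) (cauchy-distribʳ (tail f) (tail f′) g n) ⟩
    (f 0 * g (suc n) + f′ 0 * g (suc n)) + (cauchy (tail f) g n + cauchy (tail f′) g n)
      ≡⟨ interchange (f 0 * g (suc n)) (f′ 0 * g (suc n)) _ _ ⟩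
    (f 0 * g (suc n) + cauchy (tail f) g n) + (f′ 0 * g (suc n) + cauchy (tail f′) g n) ∎
    where
    interchange : ∀ a b c d → (a + b) + (c + d) ≡ (a + c) + (b + d)
    interchange = solve-∀

  cauchy-scaleˡ : ∀ c f g → cauchy (λ i → c * f i) g ≗ (λ n → c * cauchy f g n)
  cauchy-scaleˡ c f g zero    = ℤ.*-assoc c (f 0) (g 0)
  cauchy-scaleˡ c f g (suc n) = begin
    c * f 0 * g (suc n) + cauchy (λ i → c * tail f i) g n
      ≡⟨ cong₂ _+_ (ℤ.*-assoc c (f 0) (g (suc n))) (cauchy-scaleˡ c (tail f) g n) ⟩
    c * (f 0 * g (suc n)) + c * cauchy (tail f) g n
      ≡⟨ ℤ.*-distribˡ-+ c _ _ ⟨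
    c * (f 0 * g (suc n) + cauchy (tail f) g n) ∎

  -- tail (cauchy f g) is (λ i → f 0 * tail g i) ⊕ cauchy (tail f) g on the nose
  cauchy-assoc : ∀ f g h → cauchy (cauchy f g) h ≗ cauchy f (cauchy g h)
  cauchy-assoc f g h zero    = ℤ.*-assoc (f 0) (g 0) (h 0)
  cauchy-assoc f g h (suc n) = begin
    f 0 * g 0 * h (suc n) + cauchy (tail (cauchy f g)) h n
      ≡⟨ cong (_+_ (f 0 * g 0 * h (suc n))) (cauchy-distribʳ (λ i → f 0 * tail g i) (cauchy (tail f) g) h n) ⟩
    f 0 * g 0 * h (suc n) + (cauchy (λ i → f 0 * tail g i) h n + cauchy (cauchy (tail f) g) h n)
      ≡⟨ cong (_+_ (f 0 * g 0 * h (suc n))) (cong₂ _+_ (cauchy-scaleˡ (f 0) (tail g) h n) (cauchy-assoc (tail f) g h n)) ⟩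
    f 0 * g 0 * h (suc n) + (f 0 * cauchy (tail g) h n + cauchy (tail f) (cauchy g h) n)
      ≡⟨ regroup (f 0) (g 0) (h (suc n)) _ _ ⟩
    f 0 * (g 0 * h (suc n) + cauchy (tail g) h n) + cauchy (tail f) (cauchy g h) n ∎
    where
    regroup : ∀ a b c d e → a * b * c + (a * d + e) ≡ a * (b * c + d) + e
    regroup = solve-∀

  cauchy-peelʳ : ∀ f g n → cauchy f g (suc n) ≡ cauchy f (tail g) n + f (suc n) * g 0
  cauchy-peelʳ f g zero    = refl
  cauchy-peelʳ f g (suc n) = begin
    f 0 * g (suc (suc n)) + cauchy (tail f) g (suc n)
      ≡⟨ cong (_+_ (f 0 * g (suc (suc n)))) (cauchy-peelʳ (tail f) g n) ⟩
    f 0 * g (suc (suc n)) + (cauchy (tail f) (tail g) n + f (suc (suc n)) * g 0)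
      ≡⟨ ℤ.+-assoc (f 0 * g (suc (suc n))) _ _ ⟨
    f 0 * g (suc (suc n)) + cauchy (tail f) (tail g) n + f (suc (suc n)) * g 0 ∎

  cauchy-comm : ∀ f g → cauchy f g ≗ cauchy g f
  cauchy-comm f g zero    = ℤ.*-comm (f 0) (g 0)
  cauchy-comm f g (suc n) = begin
    f 0 * g (suc n) + cauchy (tail f) g n ≡⟨ cong (_+_ (f 0 * g (suc n))) (cauchy-comm (tail f) g n) ⟩
    f 0 * g (suc n) + cauchy g (tail f) n ≡⟨ ℤ.+-comm (f 0 * g (suc n)) _ ⟩
    cauchy g (tail f) n + f 0 * g (suc n) ≡⟨ cong (_+_ (cauchy g (tail f) n)) (ℤ.*-comm (f 0) (g (suc n))) ⟩
    cauchy g (tail f) n + g (suc n) * f 0 ≡⟨ cauchy-peelʳ g f n ⟨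
    cauchy g f (suc n)                    ∎

  ⊛-at-zero : ∀ f g → f 0 ≡ + 0 → (f ⊛ g) 0 ≡ + 0
  ⊛-at-zero f g f₀≡0 = trans (⊛≗cauchy f g 0) (trans (cong (_* g 0) f₀≡0) (ℤ.*-zeroˡ (g 0)))

  ⊛-at-suc : ∀ f g n → f 0 ≡ + 0 → (f ⊛ g) (suc n) ≡ cauchy (tail f) g n
  ⊛-at-suc f g n f₀≡0 = begin
    (f ⊛ g) (suc n)                        ≡⟨ ⊛≗cauchy f g (suc n) ⟩
    f 0 * g (suc n) + cauchy (tail f) g n  ≡⟨ cong (λ x → x * g (suc n) + cauchy (tail f) g n) f₀≡0 ⟩
    + 0 * g (suc n) + cauchy (tail f) g n  ≡⟨ cong (_+ cauchy (tail f) g n) (ℤ.*-zeroˡ (g (suc n))) ⟩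
    + 0 + cauchy (tail f) g n              ≡⟨ ℤ.+-identityˡ _ ⟩
    cauchy (tail f) g n                    ∎

  ⊛-via-cauchy : ∀ {f g f′ g′} → cauchy f g ≗ cauchy f′ g′ → f ⊛ g ≗ f′ ⊛ g′
  ⊛-via-cauchy {f} {g} {f′} {g′} e n = trans (⊛≗cauchy f g n) (trans (e n) (sym (⊛≗cauchy f′ g′ n)))

  ⊛-cong : ∀ {f f′ g g′} → f ≗ f′ → g ≗ g′ → f ⊛ g ≗ f′ ⊛ g′
  ⊛-cong f≗f′ g≗g′ = ⊛-via-cauchy (cauchy-cong f≗f′ g≗g′)

  ⊛-assoc : ∀ f g h → (f ⊛ g) ⊛ h ≗ f ⊛ (g ⊛ h)
  ⊛-assoc f g h = ⊛-via-cauchy λ n → begin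
    cauchy (f ⊛ g) h n       ≡⟨ cauchy-cong (⊛≗cauchy f g) (λ _ → refl) n ⟩
    cauchy (cauchy f g) h n  ≡⟨ cauchy-assoc f g h n ⟩
    cauchy f (cauchy g h) n  ≡⟨ cauchy-cong (λ _ → refl) (⊛≗cauchy g h) n ⟨
    cauchy f (g ⊛ h) n       ∎

  ⊛-comm : ∀ f g → f ⊛ g ≗ g ⊛ f
  ⊛-comm f g = ⊛-via-cauchy (cauchy-comm f g)

  ⊛-identityˡ : ∀ g → 1ₛ ⊛ g ≗ g
  ⊛-identityˡ g n = trans (⊛≗cauchy 1ₛ g n) (cauchy-identityˡ g n)

  ⊛-distribʳ : ∀ g f f′ → (f ⊕ f′) ⊛ g ≗ f ⊛ g ⊕ f′ ⊛ g
  ⊛-distribʳ g f f′ n = begin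
    ((f ⊕ f′) ⊛ g) n               ≡⟨ ⊛≗cauchy (f ⊕ f′) g n ⟩
    cauchy (f ⊕ f′) g n            ≡⟨ cauchy-distribʳ f f′ g n ⟩
    cauchy f g n + cauchy f′ g n   ≡⟨ cong₂ _+_ (⊛≗cauchy f g n) (⊛≗cauchy f′ g n) ⟨
    (f ⊛ g ⊕ f′ ⊛ g) n             ∎

  isCommutativeRing : IsCommutativeRing _≗_ _⊕_ _⊛_ ⊝_ 0ₛ 1ₛ
  isCommutativeRing = record
    { isRing = record
      { +-isAbelianGroup = Pointwise.isAbelianGroup ℕ ℤ.+-0-isAbelianGroup
      ; *-cong           = ⊛-cong
      ; *-assoc          = ⊛-assoc
      ; *-identity       = ⊛-identityˡ , λ g n → trans (⊛-comm g 1ₛ n) (⊛-identityˡ g n)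
      ; distrib          = (λ g f f′ n → trans (⊛-comm g (f ⊕ f′) n)
                                          (trans (⊛-distribʳ g f f′ n) (cong₂ _+_ (⊛-comm f g n) (⊛-comm f′ g n))))
                         , ⊛-distribʳ
      }
    ; *-comm = ⊛-comm
    }

  commutativeRing : CommutativeRing _ _
  commutativeRing = record { isCommutativeRing = isCommutativeRing }

module CubicElimination where

  open PowerSeries
  open import Data.Nat using (zero; suc)
  import Data.Integer as ℤ
  import Data.Integer.Properties as ℤ
  open import Data.Maybe using (just; nothing)
  open import Relation.Nullary using (yes; no)
  open import Relation.Binary.PropositionalEquality as ≡ using (_≗_)
  open import Algebra.Bundles using (CommutativeRing)
  open import Algebra.Solver.Ring.AlmostCommutativeRing
    using (fromCommutativeRing; _-Raw-AlmostCommutative⟶_)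
  open import Relation.Binary.Definitions using (WeaklyDecidable)

  -- Integer constants are a subring with decidable equality, so the solver can use ℤ coefficients.
  const-homomorphism : CommutativeRing.rawRing ℤ.+-*-commutativeRing
                         -Raw-AlmostCommutative⟶ fromCommutativeRing commutativeRing
  const-homomorphism = record
    { ⟦_⟧    = const
    ; +-homo = λ { c d zero → ≡.refl ; c d (suc n) → ≡.refl }
    ; *-homo = λ c d n → ≡.sym (≡.trans (⊛≗cauchy (const c) (const d) n) (const-* c d n))
    ; -‿homo = λ { c zero → ≡.refl ; c (suc n) → ≡.refl }
    ; 0-homo = λ { zero → ≡.refl ; (suc n) → ≡.refl }
    ; 1-homo = λ { zero → ≡.refl ; (suc n) → ≡.refl }
    }
    where
    const-* : ∀ c d → cauchy (const c) (const d) ≗ const (c ℤ.* d)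
    const-* c d zero    = ≡.refl
    const-* c d (suc n) = ≡.trans (cauchy-constˡ c (const d) (suc n)) (ℤ.*-zeroʳ c)

  const-≟ : WeaklyDecidable (λ c d → const c ≗ const d)
  const-≟ c d with c ℤ.≟ d
  ... | yes ≡.refl = just λ _ → ≡.refl
  ... | no _       = nothing

  open import Algebra.Solver.Ring _ _ const-homomorphism const-≟
  open CommutativeRing commutativeRing

  combination : (A z e₁ e₂ e₃ e₄ e₅ : Series) → Series
  combination A z e₁ e₂ e₃ e₄ e₅ =
    e₅ * (A * A) - (e₁ * (1# - A) * (1# - A) + z * (1# - A) * e₄ + z * A * e₃ + z * e₂)

  cubic-∈-ideal : ∀ A z H G W T →
    - (A * A * A) + T * A * A + - A + z * A * A + z + - (z * z)
    ≈ combination A z (A - (z + z * H)) (W - (A + A - z)) (G - (W + A * G)) (H - (W + A * (G + H))) (T - (1# + 1#))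
  cubic-∈-ideal = solve 6 (λ A z H G W T →
      :- (A :* A :* A) :+ T :* A :* A :+ :- A :+ z :* A :* A :+ z :+ :- (z :* z)
    := (T :- (con (+ 1) :+ con (+ 1))) :* (A :* A)
       :- ((A :- (z :+ z :* H)) :* (con (+ 1) :- A) :* (con (+ 1) :- A)
           :+ z :* (con (+ 1) :- A) :* (H :- (W :+ A :* (G :+ H)))
           :+ z :* A :* (G :- (W :+ A :* G))
           :+ z :* (W :- (A :+ A :- z))))
    refl

  -- The solver's zero: it agrees with 0# = λ _ → + 0 only up to ≈.
  0ᶜ : Series
  0ᶜ = const (+ 0)

  combination-zero : ∀ A z → combination A z 0ᶜ 0ᶜ 0ᶜ 0ᶜ 0ᶜ ≈ 0ᶜ
  combination-zero = solve 2 (λ A z →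
      con (+ 0) :* (A :* A)
       :- (con (+ 0) :* (con (+ 1) :- A) :* (con (+ 1) :- A) :+ z :* (con (+ 1) :- A) :* con (+ 0)
           :+ z :* A :* con (+ 0) :+ z :* con (+ 0))
    := con (+ 0)) refl

  combination-cong : ∀ A z {e₁ e₂ e₃ e₄ e₅ e₁′ e₂′ e₃′ e₄′ e₅′} →
    e₁ ≈ e₁′ → e₂ ≈ e₂′ → e₃ ≈ e₃′ → e₄ ≈ e₄′ → e₅ ≈ e₅′ →
    combination A z e₁ e₂ e₃ e₄ e₅ ≈ combination A z e₁′ e₂′ e₃′ e₄′ e₅′
  combination-cong A z e₁ e₂ e₃ e₄ e₅ =
    +-cong (*-cong e₅ (refl {A * A}))
      (-‿cong (+-cong (+-cong (+-cong (*-cong (*-cong e₁ (refl {1# - A})) (refl {1# - A}))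
                                      (*-cong (refl {z * (1# - A)}) e₄))
                              (*-cong (refl {z * A}) e₃))
                      (*-cong (refl {z}) e₂)))

  open import Algebra.Properties.Group +-group using (x≈y⇒x∙y⁻¹≈ε)
  open import Relation.Binary.Reasoning.Setoid setoid

  cubic-from-relations : ∀ {A z H G W T} →
    A ≈ z + z * H → W ≈ A + A - z → G ≈ W + A * G → H ≈ W + A * (G + H) → T ≈ 1# + 1# →
    - (A * A * A) + T * A * A + - A + z * A * A + z + - (z * z) ≈ 0#
  cubic-from-relations {A} {z} {H} {G} {W} {T} eA eW eG eH eT = begin
    - (A * A * A) + T * A * A + - A + z * A * A + z + - (z * z)
      ≈⟨ cubic-∈-ideal A z H G W T ⟩
    combination A z (A - (z + z * H)) (W - (A + A - z)) (G - (W + A * G)) (H - (W + A * (G + H))) (T - (1# + 1#))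
      ≈⟨ combination-cong A z (x≈y⇒x-y≈0ᶜ eA) (x≈y⇒x-y≈0ᶜ eW) (x≈y⇒x-y≈0ᶜ eG) (x≈y⇒x-y≈0ᶜ eH) (x≈y⇒x-y≈0ᶜ eT) ⟩
    combination A z 0ᶜ 0ᶜ 0ᶜ 0ᶜ 0ᶜ
      ≈⟨ combination-zero A z ⟩
    0ᶜ
      ≈⟨ 0-homo ⟩
    0# ∎
    where
    open _-Raw-AlmostCommutative⟶_ const-homomorphism using (0-homo)
    x≈y⇒x-y≈0ᶜ : ∀ {x y} → x ≈ y → x - y ≈ 0ᶜ
    x≈y⇒x-y≈0ᶜ x≈y = trans (x≈y⇒x∙y⁻¹≈ε x≈y) (sym 0-homo)

module CausalRecursion {S : Set} (initial : S) (step : ℕ → (ℕ → S) → S) where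

  open import Data.Nat using (zero; suc; _<_; s≤s)
  open import Data.Nat.Properties using (<-≤-trans)
  open import Data.Nat.Induction using (<-rec)
  open import Relation.Binary.PropositionalEquality

  Causal : Set
  Causal = ∀ n {f f′ : ℕ → S} → (∀ {k} → k < n → f k ≡ f′ k) → step n f ≡ step n f′

  iterate : ℕ → ℕ → S
  iterate zero    _ = initial
  iterate (suc i) n = step n (iterate i)

  fix : ℕ → S
  fix n = iterate (suc n) n

  module _ (causal : Causal) where

    iterate-stable : ∀ n {i} → n < i → iterate i n ≡ fix n
    iterate-stable = <-rec _ λ where
      n rec {suc i} (s≤s n≤i) → causal n λ k<n →
        trans (rec k<n (<-≤-trans k<n n≤i)) (sym (rec k<n k<n))

    fix-unfold : ∀ n → fix n ≡ step n fix
    fix-unfold n = causal n (iterate-stable _)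

module Counting where

  open import Data.Nat using (zero; suc; _+_; _*_; _∸_; _≤_; _<_; s≤s)
  open import Data.Nat.Properties using (+-0-monoid; m∸n≤m; ≤-refl)
  open import Data.Fin using (toℕ)
  open import Data.Fin.Properties using (toℕ≤pred[n])
  open import Data.Product using (_×_; _,_; proj₁; proj₂)
  open import Function using (_∘_)
  open import Algebra.Properties.Monoid.Sum +-0-monoid using (sum; sum-cong-≗)
  open import Relation.Binary.PropositionalEquality

  δ : ℕ → ℕ
  δ zero    = 1
  δ (suc _) = 0

  convolve : (ℕ → ℕ) → (ℕ → ℕ) → ℕ → ℕ
  convolve a c n = sum {suc n} λ j → a (toℕ j) * c (n ∸ toℕ j)

  convolve-cong : ∀ {a a′ c c′} n → (∀ {j} → j ≤ n → a j ≡ a′ j) → (∀ {j} → j ≤ n → c j ≡ c′ j) →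
                  convolve a c n ≡ convolve a′ c′ n
  convolve-cong n a≡a′ c≡c′ = sum-cong-≗ λ j →
    cong₂ _*_ (a≡a′ (toℕ≤pred[n] j)) (c≡c′ (m∸n≤m n (toℕ j)))

  -- n ↦ numbers of forests with n nodes, without and with a distinguished tree
  Counts : Set
  Counts = ℕ → ℕ × ℕ

  treeCount : Counts → ℕ → ℕ
  treeCount c zero    = 0
  treeCount c (suc n) = δ n + proj₂ (c n)

  rootMarkedCount : Counts → ℕ → ℕ
  rootMarkedCount c zero    = 0
  rootMarkedCount c (suc n) = δ n + (proj₂ (c n) + proj₂ (c n))

  -- convolve (treeCount c) y without its j = 0 term: that term vanishes, but keeping it would
  -- make the recursion for counts refer to the value being defined
  treesTimes : Counts → (ℕ → ℕ) → ℕ → ℕ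
  treesTimes c y zero    = 0
  treesTimes c y (suc n) = convolve (treeCount c ∘ suc) y n

  forestStep : ℕ → Counts → ℕ × ℕ
  forestStep n c = rootMarkedCount c n + treesTimes c (proj₁ ∘ c) n
                 , rootMarkedCount c n + treesTimes c (λ k → proj₁ (c k) + proj₂ (c k)) n

  open CausalRecursion (0 , 0) forestStep using (Causal; fix; fix-unfold)

  AgreeBelow : ∀ {A : Set} → ℕ → (ℕ → A) → (ℕ → A) → Set
  AgreeBelow n f f′ = ∀ {k} → k < n → f k ≡ f′ k

  rootMarkedCount-cong : ∀ n {c c′} → AgreeBelow n c c′ → rootMarkedCount c n ≡ rootMarkedCount c′ n
  rootMarkedCount-cong zero    _     = refl
  rootMarkedCount-cong (suc n) c≡c′ = cong (λ p → δ n + (proj₂ p + proj₂ p)) (c≡c′ ≤-refl)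

  treesTimes-cong : ∀ n {c c′ y y′} → AgreeBelow n c c′ → AgreeBelow n y y′ → treesTimes c y n ≡ treesTimes c′ y′ n
  treesTimes-cong zero    _    _    = refl
  treesTimes-cong (suc n) c≡c′ y≡y′ =
    convolve-cong n (λ {j} j≤n → cong (λ p → δ j + proj₂ p) (c≡c′ (s≤s j≤n))) (λ j≤n → y≡y′ (s≤s j≤n))

  forestStep-causal : Causal
  forestStep-causal n c≡c′ = cong₂ _,_
    (cong₂ _+_ (rootMarkedCount-cong n c≡c′) (treesTimes-cong n c≡c′ (cong proj₁ ∘ c≡c′)))
    (cong₂ _+_ (rootMarkedCount-cong n c≡c′)
               (treesTimes-cong n c≡c′ (λ k<n → cong (λ p → proj₁ p + proj₂ p) (c≡c′ k<n))))

  counts : Counts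
  counts = fix

  counts-unfold : ∀ n → counts n ≡ forestStep n counts
  counts-unfold = fix-unfold forestStep-causal

  mdTreeCount : ℕ → ℕ
  mdTreeCount = treeCount counts

module GradedSets where

  open import Data.Nat using (zero; suc; _+_; _*_; _∸_; _≤_; s≤s; pred)
  open import Data.Nat.Properties using (+-0-monoid; ≡-irrelevant; m≤m+n; m+n∸m≡n; m+[n∸m]≡n)
  open import Data.Fin using (toℕ; fromℕ<) renaming (zero to fzero; suc to fsuc)
  open import Data.Fin.Properties using (toℕ-fromℕ<; toℕ-injective; toℕ≤pred[n]; +↔⊎; *↔×; 0↔⊥)
  open import Data.Empty using (⊥-elim)
  open import Data.Unit using (⊤; tt)
  open import Data.Product using (Σ; _×_; _,_; proj₁)
  open import Data.Sum using (_⊎_; inj₁; inj₂; [_,_])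
  open import Data.Sum.Function.Propositional using (_⊎-↔_)
  open import Data.Product.Function.NonDependent.Propositional using (_×-↔_)
  open import Function using (_∘_; Inverse; mk↔ₛ′)
  open import Function.Properties.Inverse using (↔-refl; ↔-sym; ↔-trans)
  open import Algebra.Properties.Monoid.Sum +-0-monoid using (sum)
  open import Relation.Binary.PropositionalEquality hiding ([_])
  open Counting using (δ; convolve)
  open Inverse

  record Graded : Set₁ where
    constructor graded
    field
      Carrier : Set
      grade   : Carrier → ℕ

  open Graded public

  OfSize : Graded → ℕ → Set
  OfSize X n = Σ (Carrier X) λ x → grade X x ≡ n

  unit : Graded
  unit = graded ⊤ λ _ → 0

  shift : Graded → Graded
  shift X = graded (Carrier X) (suc ∘ grade X)

  infixr 1 _⊎ᵍ_
  infixr 2 _×ᵍ_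
  infix 0 _≅_

  _⊎ᵍ_ : Graded → Graded → Graded
  X ⊎ᵍ Y = graded (Carrier X ⊎ Carrier Y) [ grade X , grade Y ]

  _×ᵍ_ : Graded → Graded → Graded
  X ×ᵍ Y = graded (Carrier X × Carrier Y) λ (x , y) → grade X x + grade Y y

  record _≅_ (X Y : Graded) : Set where
    field
      bijection        : Carrier X ↔ Carrier Y
      grade-preserving : ∀ x → grade Y (to bijection x) ≡ grade X x

  mk≅ : ∀ {X Y} (f : Carrier X → Carrier Y) (g : Carrier Y → Carrier X) →
        (∀ y → f (g y) ≡ y) → (∀ x → g (f x) ≡ x) → (∀ x → grade Y (f x) ≡ grade X x) → X ≅ Y
  mk≅ f g f∘g g∘f preserves = record { bijection = mk↔ₛ′ f g f∘g g∘f ; grade-preserving = preserves }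

  OfSize-≡ : ∀ {X n} {x y : Carrier X} → x ≡ y → (p : grade X x ≡ n) (q : grade X y ≡ n) →
             _≡_ {A = OfSize X n} (x , p) (y , q)
  OfSize-≡ refl p q = cong (_ ,_) (≡-irrelevant p q)

  OfSize-cong : ∀ {X Y} → X ≅ Y → ∀ n → OfSize X n ↔ OfSize Y n
  OfSize-cong {X} {Y} X≅Y n = mk↔ₛ′
    (λ (x , p) → to e x , trans (preserves x) p)
    (λ (y , q) → from e y , trans (sym (preserves (from e y))) (trans (cong (grade Y) (strictlyInverseˡ e y)) q))
    (λ (y , _) → OfSize-≡ (strictlyInverseˡ e y) _ _)
    (λ (x , _) → OfSize-≡ (strictlyInverseʳ e x) _ _)
    where
    open _≅_ X≅Y renaming (bijection to e; grade-preserving to preserves)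

  OfSize-unit : ∀ n → OfSize unit n ↔ Fin (δ n)
  OfSize-unit zero    = mk↔ₛ′ (λ _ → fzero) (λ _ → tt , refl)
                          (λ { fzero → refl ; (fsuc ()) }) (λ (tt , p) → OfSize-≡ refl _ _)
  OfSize-unit (suc n) = mk↔ₛ′ (λ ()) (λ ()) (λ ()) (λ ())

  OfSize-shift-zero : ∀ X → OfSize (shift X) 0 ↔ Fin 0
  OfSize-shift-zero X = mk↔ₛ′ (λ ()) (λ ()) (λ ()) (λ ())

  OfSize-shift-suc : ∀ X n → OfSize (shift X) (suc n) ↔ OfSize X n
  OfSize-shift-suc X n = mk↔ₛ′ (λ (x , p) → x , cong pred p) (λ (x , p) → x , cong suc p)
    (λ _ → OfSize-≡ refl _ _) (λ _ → OfSize-≡ refl _ _)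

  OfSize-⊎ : ∀ X Y n → OfSize (X ⊎ᵍ Y) n ↔ (OfSize X n ⊎ OfSize Y n)
  OfSize-⊎ X Y n = mk↔ₛ′ split join split∘join join∘split
    where
    split : OfSize (X ⊎ᵍ Y) n → OfSize X n ⊎ OfSize Y n
    split (inj₁ x , p) = inj₁ (x , p)
    split (inj₂ y , p) = inj₂ (y , p)
    join : OfSize X n ⊎ OfSize Y n → OfSize (X ⊎ᵍ Y) n
    join (inj₁ (x , p)) = inj₁ x , p
    join (inj₂ (y , p)) = inj₂ y , p
    split∘join : ∀ z → split (join z) ≡ z
    split∘join (inj₁ _) = refl
    split∘join (inj₂ _) = refl
    join∘split : ∀ z → join (split z) ≡ z
    join∘split (inj₁ _ , _) = refl
    join∘split (inj₂ _ , _) = refl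

  OfSize-× : ∀ X Y n → OfSize (X ×ᵍ Y) n ↔ Σ (Fin (suc n)) λ j → OfSize X (toℕ j) × OfSize Y (n ∸ toℕ j)
  OfSize-× X Y n = mk↔ₛ′ split join split∘join join∘split
    where
    Split : Set
    Split = Σ (Fin (suc n)) λ j → OfSize X (toℕ j) × OfSize Y (n ∸ toℕ j)
    bound : ∀ {x y} → grade X x + grade Y y ≡ n → grade X x ≤ n
    bound {x} {y} p = subst (grade X x ≤_) p (m≤m+n (grade X x) (grade Y y))
    split : OfSize (X ×ᵍ Y) n → Split
    split ((x , y) , p) = fromℕ< (s≤s (bound p))
                        , (x , sym (toℕ-fromℕ< (s≤s (bound p))))
                        , (y , trans (sym (m+n∸m≡n (grade X x) (grade Y y)))
                                 (trans (cong (_∸ grade X x) p) (cong (n ∸_) (sym (toℕ-fromℕ< (s≤s (bound p)))))))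
    join : Split → OfSize (X ×ᵍ Y) n
    join (j , (x , q) , (y , r)) = (x , y) , trans (cong₂ _+_ q r) (m+[n∸m]≡n (toℕ≤pred[n] j))
    Split-≡ : ∀ {x y} {j j′ : Fin (suc n)} → j ≡ j′ → ∀ q q′ r r′ →
              _≡_ {A = Split} (j , (x , q) , (y , r)) (j′ , (x , q′) , (y , r′))
    Split-≡ refl q q′ r r′ = cong₂ (λ q r → _ , (_ , q) , (_ , r)) (≡-irrelevant q q′) (≡-irrelevant r r′)
    split∘join : ∀ z → split (join z) ≡ z
    split∘join (j , (x , q) , (y , r)) = Split-≡ (toℕ-injective (trans (toℕ-fromℕ< _) q)) _ _ _ _
    join∘split : ∀ z → join (split z) ≡ z
    join∘split _ = OfSize-≡ refl _ _

  Fin-+ : ∀ {a b} → (Fin a ⊎ Fin b) ↔ Fin (a + b)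
  Fin-+ {a} {b} = ↔-sym (+↔⊎ {a} {b})

  Fin-* : ∀ {a b} → (Fin a × Fin b) ↔ Fin (a * b)
  Fin-* {a} {b} = ↔-sym (*↔× {a} {b})

  ×-emptyˡ : ∀ {A B : Set} → A ↔ Fin 0 → (A × B) ↔ Fin 0
  ×-emptyˡ A↔0 = mk↔ₛ′ (to A↔0 ∘ proj₁) (λ ()) (λ ()) (λ (a , _) → ⊥-elim (to 0↔⊥ (to A↔0 a)))

  Σ-Fin-suc : ∀ {k} (F : Fin (suc k) → Set) → Σ (Fin (suc k)) F ↔ (F fzero ⊎ Σ (Fin k) (F ∘ fsuc))
  Σ-Fin-suc F = mk↔ₛ′ split join split∘join join∘split
    where
    split : Σ _ F → F fzero ⊎ Σ _ (F ∘ fsuc)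
    split (fzero  , x) = inj₁ x
    split (fsuc j , x) = inj₂ (j , x)
    join : F fzero ⊎ Σ _ (F ∘ fsuc) → Σ _ F
    join (inj₁ x)       = fzero , x
    join (inj₂ (j , x)) = fsuc j , x
    split∘join : ∀ z → split (join z) ≡ z
    split∘join (inj₁ _) = refl
    split∘join (inj₂ _) = refl
    join∘split : ∀ z → join (split z) ≡ z
    join∘split (fzero  , _) = refl
    join∘split (fsuc _ , _) = refl

  Σ-Fin-count : ∀ {k} {F : Fin k → Set} (c : Fin k → ℕ) → (∀ j → F j ↔ Fin (c j)) → Σ (Fin k) F ↔ Fin (sum c)
  Σ-Fin-count {zero}  c _   = mk↔ₛ′ (λ ()) (λ ()) (λ ()) (λ ())
  Σ-Fin-count {suc k} {F} c F↔c = ↔-trans (Σ-Fin-suc F) (↔-trans (F↔c fzero ⊎-↔ Σ-Fin-count (c ∘ fsuc) (F↔c ∘ fsuc)) Fin-+)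

  ≡⇒Fin↔ : ∀ {a b} → a ≡ b → Fin a ↔ Fin b
  ≡⇒Fin↔ refl = ↔-refl

  count-⊎ : ∀ {X Y n a b} → OfSize X n ↔ Fin a → OfSize Y n ↔ Fin b → OfSize (X ⊎ᵍ Y) n ↔ Fin (a + b)
  count-⊎ {X} {Y} {n} X↔a Y↔b = ↔-trans (OfSize-⊎ X Y n) (↔-trans (X↔a ⊎-↔ Y↔b) Fin-+)

  count-×⁺ : ∀ {X Y n a y} → OfSize X 0 ↔ Fin 0 →
    (∀ (j : Fin (suc n)) → OfSize X (suc (toℕ j)) ↔ Fin (a (toℕ j))) →
    (∀ (j : Fin (suc n)) → OfSize Y (n ∸ toℕ j) ↔ Fin (y (n ∸ toℕ j))) →
    OfSize (X ×ᵍ Y) (suc n) ↔ Fin (convolve a y n)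
  count-×⁺ {X} {Y} {n} {a} {y} X₀↔0 X↔a Y↔y = ↔-trans (OfSize-× X Y (suc n)) (Σ-Fin-count c split↔c)
    where
    c : Fin (suc (suc n)) → ℕ
    c fzero    = 0
    c (fsuc j) = a (toℕ j) * y (n ∸ toℕ j)
    split↔c : ∀ j → (OfSize X (toℕ j) × OfSize Y (suc n ∸ toℕ j)) ↔ Fin (c j)
    split↔c fzero    = ×-emptyˡ X₀↔0
    split↔c (fsuc j) = ↔-trans (X↔a j ×-↔ Y↔y j) Fin-*

  count-×-zero : ∀ {X Y} → OfSize X 0 ↔ Fin 0 → OfSize (X ×ᵍ Y) 0 ↔ Fin 0
  count-×-zero {X} {Y} X₀↔0 = ↔-trans (OfSize-× X Y 0) (Σ-Fin-count (λ _ → 0) λ { fzero → ×-emptyˡ X₀↔0 })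

module TreeDecomposition where

  open import Data.Nat using (suc)
  open import Data.Nat.Properties using (+-identityʳ)
  open import Data.Fin using () renaming (zero to fzero; suc to fsuc)
  open import Data.Unit using (⊤; tt)
  open import Data.Bool using (true; false)
  open import Data.List using (List; []; _∷_)
  open import Data.List.Relation.Unary.All using (All; []; _∷_)
  open import Data.Product using (Σ; _×_; _,_; proj₁)
  open import Data.Sum using (_⊎_; inj₁; inj₂)
  open import Function using (_∘_)
  open import Relation.Binary.PropositionalEquality using (refl; sym)
  open GradedSets

  mdTrees : Graded
  mdTrees = graded MDTree (size ∘ proj₁)

  -- The children of a node: a nonempty list of decorated subtrees with the marking choice
  -- of the rightmost edge; a pointed forest also has its distinguished child chosen.
  Forest : Set
  Forest = Σ Tree λ c → Σ (List Tree) λ cs → MarkChoice (c ∷ cs) × All Deco (c ∷ cs)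

  PointedForest : Set
  PointedForest = Σ Tree λ c → Σ (List Tree) λ cs →
                    MarkChoice (c ∷ cs) × DistChoice (c ∷ cs) × All Deco (c ∷ cs)

  forests : Graded
  forests = graded Forest λ (c , cs , _) → sizeList (c ∷ cs)

  pointedForests : Graded
  pointedForests = graded PointedForest λ (c , cs , _) → sizeList (c ∷ cs)

  -- A decorated tree in rightmost position, with the marking choice of the edge above it.
  rootMarkedTrees : Graded
  rootMarkedTrees = graded (Σ MDTree (RightMark ∘ proj₁)) (size ∘ proj₁ ∘ proj₁)

  mdTrees≅ : mdTrees ≅ shift (unit ⊎ᵍ pointedForests)
  mdTrees≅ = mk≅ to from (λ { (inj₁ _) → refl ; (inj₂ _) → refl }) from∘to to-preserves
    where
    to : MDTree → ⊤ ⊎ PointedForest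
    to (node []       , _)             = inj₁ tt
    to (node (c ∷ cs) , deco m d ds) = inj₂ (c , cs , m , d , ds)
    from : ⊤ ⊎ PointedForest → MDTree
    from (inj₁ _)                    = node [] , deco tt tt []
    from (inj₂ (c , cs , m , d , ds)) = node (c ∷ cs) , deco m d ds
    from∘to : ∀ t → from (to t) ≡ t
    from∘to (node []       , deco _ _ []) = refl
    from∘to (node (_ ∷ _) , deco _ _ _)  = refl
    to-preserves : ∀ t → grade (shift (unit ⊎ᵍ pointedForests)) (to t) ≡ size (proj₁ t)
    to-preserves (node []       , _)           = refl
    to-preserves (node (_ ∷ _) , deco _ _ _) = refl

  rootMarkedTrees≅ : rootMarkedTrees ≅ shift (unit ⊎ᵍ pointedForests ⊎ᵍ pointedForests)
  rootMarkedTrees≅ = mk≅ to from to∘from from∘to to-preserves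
    where
    to : Σ MDTree (RightMark ∘ proj₁) → ⊤ ⊎ PointedForest ⊎ PointedForest
    to ((node []       , _)            , _)     = inj₁ tt
    to ((node (c ∷ cs) , deco m d ds) , true)  = inj₂ (inj₁ (c , cs , m , d , ds))
    to ((node (c ∷ cs) , deco m d ds) , false) = inj₂ (inj₂ (c , cs , m , d , ds))
    from : ⊤ ⊎ PointedForest ⊎ PointedForest → Σ MDTree (RightMark ∘ proj₁)
    from (inj₁ _)                             = (node [] , deco tt tt []) , tt
    from (inj₂ (inj₁ (c , cs , m , d , ds))) = (node (c ∷ cs) , deco m d ds) , true
    from (inj₂ (inj₂ (c , cs , m , d , ds))) = (node (c ∷ cs) , deco m d ds) , false
    to∘from : ∀ x → to (from x) ≡ x
    to∘from (inj₁ _)        = refl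
    to∘from (inj₂ (inj₁ _)) = refl
    to∘from (inj₂ (inj₂ _)) = refl
    from∘to : ∀ t → from (to t) ≡ t
    from∘to ((node []       , deco _ _ []) , _)     = refl
    from∘to ((node (_ ∷ _) , deco _ _ _)  , true)  = refl
    from∘to ((node (_ ∷ _) , deco _ _ _)  , false) = refl
    to-preserves : ∀ t → grade (shift (unit ⊎ᵍ pointedForests ⊎ᵍ pointedForests)) (to t) ≡ size (proj₁ (proj₁ t))
    to-preserves ((node []       , _) , _)     = refl
    to-preserves ((node (_ ∷ _) , deco _ _ _) , true)  = refl
    to-preserves ((node (_ ∷ _) , deco _ _ _) , false) = refl

  -- Split off the leftmost child: it is either the rightmost one too, and then carries the
  -- mark, or it is followed by a smaller forest (containing the distinguished child or not).
  forests≅ : forests ≅ rootMarkedTrees ⊎ᵍ mdTrees ×ᵍ forests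
  forests≅ = mk≅ to from (λ { (inj₁ _) → refl ; (inj₂ _) → refl }) from∘to to-preserves
    where
    to : Forest → Σ MDTree (RightMark ∘ proj₁) ⊎ MDTree × Forest
    to (c , []     , m , dc ∷ [])  = inj₁ ((c , dc) , m)
    to (c , d ∷ ds , m , dc ∷ dds) = inj₂ ((c , dc) , d , ds , m , dds)
    from : Σ MDTree (RightMark ∘ proj₁) ⊎ MDTree × Forest → Forest
    from (inj₁ ((c , dc) , m))              = c , []     , m , dc ∷ []
    from (inj₂ ((c , dc) , d , ds , m , dds)) = c , d ∷ ds , m , dc ∷ dds
    from∘to : ∀ f → from (to f) ≡ f
    from∘to (_ , []    , _ , _ ∷ []) = refl
    from∘to (_ , _ ∷ _ , _ , _ ∷ _)  = refl
    to-preserves : ∀ f → grade (rootMarkedTrees ⊎ᵍ mdTrees ×ᵍ forests) (to f) ≡ grade forests f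
    to-preserves (c , []    , _ , _ ∷ []) = sym (+-identityʳ (size c))
    to-preserves (_ , _ ∷ _ , _ , _ ∷ _)  = refl

  pointedForests≅ : pointedForests ≅ rootMarkedTrees ⊎ᵍ mdTrees ×ᵍ (forests ⊎ᵍ pointedForests)
  pointedForests≅ = mk≅ to from to∘from from∘to to-preserves
    where
    to : PointedForest → Σ MDTree (RightMark ∘ proj₁) ⊎ MDTree × (Forest ⊎ PointedForest)
    to (c , []     , m , fzero  , dc ∷ [])  = inj₁ ((c , dc) , m)
    to (c , d ∷ ds , m , fzero  , dc ∷ dds) = inj₂ ((c , dc) , inj₁ (d , ds , m , dds))
    to (c , d ∷ ds , m , fsuc i , dc ∷ dds) = inj₂ ((c , dc) , inj₂ (d , ds , m , i , dds))
    from : Σ MDTree (RightMark ∘ proj₁) ⊎ MDTree × (Forest ⊎ PointedForest) → PointedForest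
    from (inj₁ ((c , dc) , m))                      = c , []     , m , fzero  , dc ∷ []
    from (inj₂ ((c , dc) , inj₁ (d , ds , m , dds)))     = c , d ∷ ds , m , fzero  , dc ∷ dds
    from (inj₂ ((c , dc) , inj₂ (d , ds , m , i , dds))) = c , d ∷ ds , m , fsuc i , dc ∷ dds
    to∘from : ∀ x → to (from x) ≡ x
    to∘from (inj₁ _)            = refl
    to∘from (inj₂ (_ , inj₁ _)) = refl
    to∘from (inj₂ (_ , inj₂ _)) = refl
    from∘to : ∀ f → from (to f) ≡ f
    from∘to (_ , []    , _ , fzero  , _ ∷ []) = refl
    from∘to (_ , _ ∷ _ , _ , fzero  , _ ∷ _)  = refl
    from∘to (_ , _ ∷ _ , _ , fsuc _ , _ ∷ _)  = refl
    to-preserves : ∀ f → grade (rootMarkedTrees ⊎ᵍ mdTrees ×ᵍ (forests ⊎ᵍ pointedForests)) (to f)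
                         ≡ grade pointedForests f
    to-preserves (c , []    , _ , fzero  , _ ∷ []) = sym (+-identityʳ (size c))
    to-preserves (_ , _ ∷ _ , _ , fzero  , _ ∷ _)  = refl
    to-preserves (_ , _ ∷ _ , _ , fsuc _ , _ ∷ _)  = refl

module Enumeration where

  open import Data.Nat using (zero; suc; _<_; s≤s)
  open import Data.Nat.Properties using (≤-refl; m∸n≤m)
  open import Data.Nat.Induction using (<-rec)
  open import Data.Fin using (toℕ)
  open import Data.Fin.Properties using (toℕ≤pred[n])
  open import Data.Product using (_×_; _,_; proj₁; proj₂)
  open import Function using (_∘_)
  open import Function.Properties.Inverse using (↔-sym; ↔-trans)
  open import Relation.Binary.PropositionalEquality using (sym; cong)
  open Counting
  open GradedSets
  open TreeDecomposition

  Enumerated : ℕ → Set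
  Enumerated n = (OfSize forests n ↔ Fin (proj₁ (counts n)))
               × (OfSize pointedForests n ↔ Fin (proj₂ (counts n)))

  EnumeratedBelow : ℕ → Set
  EnumeratedBelow n = ∀ {k} → k < n → Enumerated k

  mdTrees-zero : OfSize mdTrees 0 ↔ Fin 0
  mdTrees-zero = ↔-trans (OfSize-cong mdTrees≅ 0) (OfSize-shift-zero _)

  mdTrees-suc : ∀ n → OfSize pointedForests n ↔ Fin (proj₂ (counts n)) →
                OfSize mdTrees (suc n) ↔ Fin (treeCount counts (suc n))
  mdTrees-suc n P↔ = ↔-trans (OfSize-cong mdTrees≅ (suc n))
                       (↔-trans (OfSize-shift-suc _ n) (count-⊎ (OfSize-unit n) P↔))

  rootMarkedTrees-count : ∀ n → EnumeratedBelow n → OfSize rootMarkedTrees n ↔ Fin (rootMarkedCount counts n)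
  rootMarkedTrees-count zero    _     = ↔-trans (OfSize-cong rootMarkedTrees≅ 0) (OfSize-shift-zero _)
  rootMarkedTrees-count (suc n) below = ↔-trans (OfSize-cong rootMarkedTrees≅ (suc n))
    (↔-trans (OfSize-shift-suc _ n) (count-⊎ (OfSize-unit n) (count-⊎ P↔ P↔)))
    where P↔ = proj₂ (below ≤-refl)

  mdTrees×-count : ∀ {Y y} n → EnumeratedBelow n → (∀ {k} → k < n → OfSize Y k ↔ Fin (y k)) →
                   OfSize (mdTrees ×ᵍ Y) n ↔ Fin (treesTimes counts y n)
  mdTrees×-count zero    _     _  = count-×-zero mdTrees-zero
  mdTrees×-count {y = y} (suc n) below Y↔ = count-×⁺ {a = treeCount counts ∘ suc} {y} mdTrees-zero
    (λ j → mdTrees-suc (toℕ j) (proj₂ (below (s≤s (toℕ≤pred[n] j)))))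
    (λ j → Y↔ (s≤s (m∸n≤m n (toℕ j))))

  enumerated : ∀ n → Enumerated n
  enumerated = <-rec Enumerated λ n below →
      ↔-trans (OfSize-cong forests≅ n)
        (↔-trans (count-⊎ (rootMarkedTrees-count n below) (mdTrees×-count n below (proj₁ ∘ below)))
                 (≡⇒Fin↔ (sym (cong proj₁ (counts-unfold n)))))
    , ↔-trans (OfSize-cong pointedForests≅ n)
        (↔-trans (count-⊎ (rootMarkedTrees-count n below)
                          (mdTrees×-count n below λ k<n → count-⊎ (proj₁ (below k<n)) (proj₂ (below k<n))))
                 (≡⇒Fin↔ (sym (cong proj₂ (counts-unfold n)))))

  mdTrees-count : ∀ n → Fin (mdTreeCount n) ↔ MDTreeOfSize n
  mdTrees-count zero    = ↔-sym mdTrees-zero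
  mdTrees-count (suc n) = ↔-sym (mdTrees-suc n (proj₂ (enumerated n)))

module GeneratingFunctions where

  open import Data.Nat as ℕ using (zero; suc)
  open import Data.Nat.Properties using (+-identityʳ)
  open import Data.Integer using (_+_; -_)
  import Data.Integer.Properties as ℤ
  open import Data.Integer.Tactic.RingSolver using (solve-∀)
  open import Data.Product using (proj₁; proj₂)
  open import Function using (_∘_)
  open import Relation.Binary.PropositionalEquality
  open ≡-Reasoning
  open PowerSeries
  open Counting

  A G H W : Series
  A = genFun mdTreeCount
  G = +_ ∘ proj₁ ∘ counts
  H = +_ ∘ proj₂ ∘ counts
  W = +_ ∘ rootMarkedCount counts

  cauchy-+ : ∀ a c n → cauchy (+_ ∘ a) (+_ ∘ c) n ≡ + convolve a c n
  cauchy-+ a c zero    = trans (sym (ℤ.pos-* (a 0) (c 0))) (cong +_ (sym (+-identityʳ (a 0 ℕ.* c 0))))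
  cauchy-+ a c (suc n) = trans (cong₂ _+_ (sym (ℤ.pos-* (a 0) (c (suc n)))) (cauchy-+ (a ∘ suc) c n))
                               (sym (ℤ.pos-+ (a 0 ℕ.* c (suc n)) _))

  A⊛-treesTimes : ∀ {Y} y → Y ≗ +_ ∘ y → ∀ n → (A ⊛ Y) n ≡ + treesTimes counts y n
  A⊛-treesTimes {Y} y Y≗y zero    = ⊛-at-zero A Y refl
  A⊛-treesTimes {Y} y Y≗y (suc n) = begin
    (A ⊛ Y) (suc n)                                  ≡⟨ ⊛-at-suc A Y n refl ⟩
    cauchy (+_ ∘ treeCount counts ∘ suc) Y n         ≡⟨ cauchy-cong (λ _ → refl) Y≗y n ⟩
    cauchy (+_ ∘ treeCount counts ∘ suc) (+_ ∘ y) n  ≡⟨ cauchy-+ (treeCount counts ∘ suc) y n ⟩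
    + treesTimes counts y (suc n)                    ∎

  zS⊛-suc : ∀ f n → (zS ⊛ f) (suc n) ≡ f n
  zS⊛-suc f n = begin
    (zS ⊛ f) (suc n)      ≡⟨ ⊛-at-suc zS f n refl ⟩
    cauchy (tail zS) f n  ≡⟨ cauchy-cong tail-zS (λ _ → refl) n ⟩
    cauchy 1ₛ f n         ≡⟨ cauchy-identityˡ f n ⟩
    f n                   ∎
    where
    tail-zS : tail zS ≗ 1ₛ
    tail-zS zero    = refl
    tail-zS (suc _) = refl

  zS-suc : ∀ n → zS (suc n) ≡ + δ n
  zS-suc zero    = refl
  zS-suc (suc _) = refl

  A-relation : A ≗ zS ⊕ zS ⊛ H
  A-relation zero    = sym (cong (_+_ (+ 0)) (⊛-at-zero zS H refl))
  A-relation (suc n) = begin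
    + (δ n ℕ.+ proj₂ (counts n))  ≡⟨ ℤ.pos-+ (δ n) _ ⟩
    + δ n + H n                   ≡⟨ cong₂ _+_ (zS-suc n) (zS⊛-suc H n) ⟨
    zS (suc n) + (zS ⊛ H) (suc n) ∎

  W-relation : W ≗ A ⊕ A ⊕ ⊝ zS
  W-relation zero    = refl
  W-relation (suc n) = begin
    + (δ n ℕ.+ (h ℕ.+ h))                     ≡⟨ trans (ℤ.pos-+ (δ n) _) (cong (_+_ (+ δ n)) (ℤ.pos-+ h h)) ⟩
    + δ n + (+ h + + h)                       ≡⟨ double (+ δ n) (+ h) ⟩
    (+ δ n + + h) + (+ δ n + + h) + - + δ n   ≡⟨ cong₂ (λ a z → a + a + - z) (sym (ℤ.pos-+ (δ n) h)) (sym (zS-suc n)) ⟩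
    A (suc n) + A (suc n) + - zS (suc n)      ∎
    where
    h = proj₂ (counts n)
    double : ∀ d x → d + (x + x) ≡ (d + x) + (d + x) + - d
    double = solve-∀

  W⊕A⊛-treesTimes : ∀ {Y} y → Y ≗ +_ ∘ y → ∀ n →
                    (W ⊕ A ⊛ Y) n ≡ + (rootMarkedCount counts n ℕ.+ treesTimes counts y n)
  W⊕A⊛-treesTimes y Y≗y n = trans (cong (_+_ (W n)) (A⊛-treesTimes y Y≗y n)) (sym (ℤ.pos-+ (rootMarkedCount counts n) _))

  G-relation : G ≗ W ⊕ A ⊛ G
  G-relation n = trans (cong (+_ ∘ proj₁) (counts-unfold n)) (sym (W⊕A⊛-treesTimes _ (λ _ → refl) n))

  H-relation : H ≗ W ⊕ A ⊛ (G ⊕ H)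
  H-relation n = trans (cong (+_ ∘ proj₂) (counts-unfold n))
    (sym (W⊕A⊛-treesTimes _ (λ k → sym (ℤ.pos-+ (proj₁ (counts k)) (proj₂ (counts k)))) n))

  twoS-relation : twoS ≗ 1ₛ ⊕ 1ₛ
  twoS-relation zero    = refl
  twoS-relation (suc _) = refl

open import Data.Product using (_,_)
open import Relation.Binary.PropositionalEquality using (refl)
open Counting using (mdTreeCount)
open Enumeration using (mdTrees-count)
open CubicElimination using (cubic-from-relations)
open GeneratingFunctions using (A-relation; W-relation; G-relation; H-relation; twoS-relation)

mainTheorem3 : Σ (ℕ → ℕ) (λ b →
    ((n : ℕ) → Fin (b n) ↔ MDTreeOfSize n)
    × ((n : ℕ) →
        let A = genFun b in
        (⊝ (A ⊛ A ⊛ A) ⊕ twoS ⊛ A ⊛ A ⊕ ⊝ A ⊕ zS ⊛ A ⊛ A ⊕ zS ⊕ ⊝ (zS ⊛ zS)) n ≡ + 0)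
    × (b 1 ≡ 1 × b 2 ≡ 1 × b 3 ≡ 4 × b 4 ≡ 17 × b 5 ≡ 78 × b 6 ≡ 378))
mainTheorem3 =
    mdTreeCount
  , mdTrees-count
  , cubic-from-relations A-relation W-relation G-relation H-relation twoS-relation
  , refl , refl , refl , refl , refl , refl
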